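{- Let $\alpha$ and $\beta$ be finite words on positive integers. Then $\mathcal T_\alpha=\mathcal T_\beta$ if and only if $s_{[\alpha]}=s_{[\beta]}$.
   Context: A tower diagram is a sequence $\mathcal T=(\mathcal T_1,\mathcal T_2,\ldots)$ of nonnegative integers, almost all zero ($\mathcal T_p$ is the height of the $p$-th tower). Sliding a positive integer $i$ into $\mathcal T$ gives the diagram $i\searrow\mathcal T$ defined as follows: set $s:=i$ and examine towers $p=1,2,3,\ldots$ in order, with $h=\mathcal T_p$: if $s>p+h$, go to the next tower; if $s=p+h$, increase $\mathcal T_p$ by one and stop (addition); if $h\ge1$ and $s=p+h-1$, decrease $\mathcal T_p$ by one and stop (deletion); if $s<p+h-1$, replace $s$ by $s+1$ and go to the next tower. For a word $\alpha=\alpha_1\cdots\alpha_l$ of positive integers, $\alpha\searrow\mathcal T:=\alpha_l\searrow(\cdots\searrow(\alpha_1\searrow\mathcal T))$, and $\mathcal T_\alpha:=\alpha\searrow\varnothing$ where $\varnothing$ is the all-zero diagram. Also $s_{[\alpha]}:=s_{\alpha_1}s_{\alpha_2}\cdots s_{\alpha_l}$, where $s_p$ is the adjacent transposition $(p\ p+1)$. -}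

module Defs where

open import Data.Nat using (ℕ; zero; suc; _+_; _∸_; _<?_)
open import Data.Nat.Properties using (_≟_)
open import Data.List using (List; []; _∷_; replicate; _++_; [_]; foldl; foldr; map)
open import Relation.Nullary using (yes; no)
open import Relation.Binary.PropositionalEquality using (_≡_)
open import Function using (_∘_; id)

-- A tower diagram is encoded as a finite list of heights:
-- the list element at (0-based) position k is the height of tower k+1,
-- and all towers beyond the end of the list have height 0.
TowerDiagram : Set
TowerDiagram = List ℕ

∅ᵀ : TowerDiagram
∅ᵀ = []

-- tower T p = 𝒯_p  (height of the p-th tower, p ≥ 1; tower T 0 = 0 by convention)
tower : TowerDiagram → ℕ → ℕ
tower T zero = 0
tower [] (suc k) = 0
tower (h ∷ T) (suc zero) = h
tower (h ∷ T) (suc (suc k)) = tower T (suc k)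

_≈ᵀ_ : TowerDiagram → TowerDiagram → Set
T ≈ᵀ T' = ∀ p → tower T p ≡ tower T' p

-- slideAt s p T : the sliding procedure with current value s, currently
-- examining tower p, where T lists the heights of towers p, p+1, ….
-- Beyond the end of the list all heights are 0; there (given the invariant
-- s ≥ p, always maintained by the procedure) the towers p,…,s-1 are skipped
-- (s > p + 0) and tower s receives an addition (s = s + 0).
slideAt : ℕ → ℕ → List ℕ → List ℕ
slideAt s p [] = replicate (s ∸ p) 0 ++ [ 1 ]
slideAt s p (h ∷ T) with p + h <? s
... | yes _ = h ∷ slideAt s (suc p) T
... | no _ with s ≟ p + h
...   | yes _ = suc h ∷ T
...   | no _ with h
...     | zero = h ∷ slideAt (suc s) (suc p) T         -- (h = 0, s < p + h - 1 case)
...     | suc h' with s ≟ p + h'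
...       | yes _ = h' ∷ T                             -- h ≥ 1, s = p + h - 1 : deletion
...       | no _ = h ∷ slideAt (suc s) (suc p) T

slide : ℕ → TowerDiagram → TowerDiagram
slide i T = slideAt i 1 T

slideWord : List ℕ → TowerDiagram → TowerDiagram
slideWord α T = foldl (λ U a → slide a U) T α

towerOf : List ℕ → TowerDiagram
towerOf α = slideWord α ∅ᵀ

transp : ℕ → ℕ → ℕ
transp p n with n ≟ p
... | yes _ = suc p
... | no _ with n ≟ suc p
...   | yes _ = p
...   | no _ = n

perm : List ℕ → ℕ → ℕ
perm α = foldr (λ a f → transp a ∘ f) id α

_≈ᵖ_ : (ℕ → ℕ) → (ℕ → ℕ) → Set
f ≈ᵖ g = ∀ n → f n ≡ g n

module Submission where

-- Fix N larger than every letter of the words involved and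
-- encode a permutation w of {1,…,N} (extended by the identity) by its
-- Lehmer code: code w p = #{ j | p < j ≤ N, w j < w p }.
--   1. The code determines the permutation: from the codes of the positions
--      1,…,p one recovers w p as 1 + #{q < p | w q < w p} + code w p,
--      which pins w p down by induction on p.
--   2. Sliding i into the tower diagram of w yields the tower diagram of
--      s_i ∘ w: exactly one code entry changes (at the earlier of the two
--      positions holding the values i and i+1), and the sliding procedure
--      passes over all earlier towers, then adds or deletes a box exactly
--      there.

open import Defs
open import Data.Nat
open import Data.Nat.Properties
open import Data.Nat.Induction using (<-rec)
open import Data.Nat.Tactic.RingSolver using (solve-∀)
open import Data.List using (List; []; _∷_; foldr)
open import Data.List.Relation.Unary.All using (All; []; _∷_)
open import Data.Empty using (⊥; ⊥-elim)
open import Data.Sum using (_⊎_; inj₁; inj₂)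
open import Data.Product using (_×_; _,_; proj₁; proj₂)
open import Relation.Nullary using (yes; no)
open import Relation.Binary.PropositionalEquality
open import Relation.Binary.Definitions using (tri<; tri≈; tri>)

-- 0/1 indicators of x < y and x = y, so that counts become sums.

isLess : ℕ → ℕ → ℕ
isLess _ zero = 0
isLess zero (suc _) = 1
isLess (suc x) (suc y) = isLess x y

isEq : ℕ → ℕ → ℕ
isEq zero zero = 1
isEq zero (suc _) = 0
isEq (suc _) zero = 0
isEq (suc x) (suc y) = isEq x y

isLess-yes : ∀ {x y} → x < y → isLess x y ≡ 1
isLess-yes {zero} {suc y} _ = refl
isLess-yes {suc x} {suc y} (s≤s x<y) = isLess-yes x<y

isLess-no : ∀ {x y} → y ≤ x → isLess x y ≡ 0
isLess-no {x} {zero} _ = refl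
isLess-no {suc x} {suc y} (s≤s y≤x) = isLess-no y≤x

isEq-yes : ∀ {x y} → x ≡ y → isEq x y ≡ 1
isEq-yes {zero} refl = refl
isEq-yes {suc x} refl = isEq-yes {x} refl

isEq-no : ∀ {x y} → x ≢ y → isEq x y ≡ 0
isEq-no {zero} {zero} x≢y = ⊥-elim (x≢y refl)
isEq-no {zero} {suc y} _ = refl
isEq-no {suc x} {zero} _ = refl
isEq-no {suc x} {suc y} x≢y = isEq-no (λ e → x≢y (cong suc e))

isLess-sucʳ : ∀ x y → isLess x (suc y) ≡ isLess x y + isEq x y
isLess-sucʳ zero zero = refl
isLess-sucʳ zero (suc y) = refl
isLess-sucʳ (suc x) zero = refl
isLess-sucʳ (suc x) (suc y) = isLess-sucʳ x y

isLess-sucˡ : ∀ x y → isLess x y ≡ isLess (suc x) y + isEq (suc x) y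
isLess-sucˡ x zero = refl
isLess-sucˡ zero (suc zero) = refl
isLess-sucˡ zero (suc (suc y)) = refl
isLess-sucˡ (suc x) (suc y) = isLess-sucˡ x y

isLess-sucʳ-≢ : ∀ {x y} → x ≢ y → isLess x (suc y) ≡ isLess x y
isLess-sucʳ-≢ {x} {y} x≢y =
  trans (isLess-sucʳ x y) (trans (cong (isLess x y +_) (isEq-no x≢y)) (+-identityʳ _))

isLess-sucˡ-≢ : ∀ {x y} → suc x ≢ y → isLess (suc x) y ≡ isLess x y
isLess-sucˡ-≢ {x} {y} x+1≢y =
  sym (trans (isLess-sucˡ x y) (trans (cong (isLess (suc x) y +_) (isEq-no x+1≢y)) (+-identityʳ _)))

sumFrom : (ℕ → ℕ) → ℕ → ℕ → ℕ
sumFrom f lo zero = 0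
sumFrom f lo (suc n) = f lo + sumFrom f (suc lo) n

widen : ∀ {lo n j} → suc lo ≤ j → j < suc lo + n → lo ≤ j × j < lo + suc n
widen {lo} {n} {j} lo<j j<end = ≤-trans (n≤1+n lo) lo<j , subst (j <_) (sym (+-suc lo n)) j<end

lo<lo+suc : ∀ lo n → lo < lo + suc n
lo<lo+suc lo n = subst (lo <_) (sym (+-suc lo n)) (s≤s (m≤m+n lo n))

sumFrom-cong : ∀ f g lo n → (∀ j → lo ≤ j → j < lo + n → f j ≡ g j) → sumFrom f lo n ≡ sumFrom g lo n
sumFrom-cong f g lo zero _ = refl
sumFrom-cong f g lo (suc n) f≗g =
  cong₂ _+_ (f≗g lo ≤-refl (lo<lo+suc lo n))
            (sumFrom-cong f g (suc lo) n (λ j l r → let (l' , r') = widen {lo} {n} l r in f≗g j l' r'))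

sumFrom-zero : ∀ f lo n → (∀ j → lo ≤ j → j < lo + n → f j ≡ 0) → sumFrom f lo n ≡ 0
sumFrom-zero f lo n f≗0 = trans (sumFrom-cong f (λ _ → 0) lo n f≗0) (sum-of-zeros n lo)
  where
  sum-of-zeros : ∀ n lo → sumFrom (λ _ → 0) lo n ≡ 0
  sum-of-zeros zero lo = refl
  sum-of-zeros (suc n) lo = sum-of-zeros n (suc lo)

sumFrom-+ : ∀ f g lo n → sumFrom (λ j → f j + g j) lo n ≡ sumFrom f lo n + sumFrom g lo n
sumFrom-+ f g lo zero = refl
sumFrom-+ f g lo (suc n) rewrite sumFrom-+ f g (suc lo) n =
  interchange (f lo) (g lo) (sumFrom f (suc lo) n) (sumFrom g (suc lo) n)
  where
  interchange : ∀ a b c d → a + b + (c + d) ≡ a + c + (b + d)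
  interchange = solve-∀

sumFrom-split : ∀ f lo m n → sumFrom f lo (m + n) ≡ sumFrom f lo m + sumFrom f (lo + m) n
sumFrom-split f lo zero n rewrite +-identityʳ lo = refl
sumFrom-split f lo (suc m) n rewrite sumFrom-split f (suc lo) m n | +-suc lo m = sym (+-assoc (f lo) _ _)

sumFrom-snoc : ∀ f lo n → sumFrom f lo (suc n) ≡ sumFrom f lo n + f (lo + n)
sumFrom-snoc f lo n =
  trans (cong (sumFrom f lo) (+-comm 1 n))
        (trans (sumFrom-split f lo n 1) (cong (sumFrom f lo n +_) (+-identityʳ _)))

term≤sumFrom : ∀ f lo n t → lo ≤ t → t < lo + n → f t ≤ sumFrom f lo n
term≤sumFrom f lo zero t lo≤t t<end = ⊥-elim (<-irrefl refl (≤-<-trans lo≤t (subst (t <_) (+-identityʳ lo) t<end)))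
term≤sumFrom f lo (suc n) t lo≤t t<end with lo ≟ t
... | yes refl = m≤m+n (f lo) _
... | no lo≢t = ≤-trans (term≤sumFrom f (suc lo) n t (≤∧≢⇒< lo≤t lo≢t) (subst (t <_) (+-suc lo n) t<end))
                        (m≤n+m _ (f lo))

sumFrom-exchange : ∀ f g lo n t → lo ≤ t → t < lo + n → (∀ j → lo ≤ j → j < lo + n → j ≢ t → f j ≡ g j)
  → sumFrom f lo n + g t ≡ sumFrom g lo n + f t
sumFrom-exchange f g lo zero t lo≤t t<end _ = ⊥-elim (<-irrefl refl (≤-<-trans lo≤t (subst (t <_) (+-identityʳ lo) t<end)))
sumFrom-exchange f g lo (suc n) t lo≤t t<end f≗g with lo ≟ t
... | yes refl = trans (cong (λ r → f lo + r + g lo) rest) (rearrange (f lo) (g lo) (sumFrom g (suc lo) n))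
  where
  rearrange : ∀ a b c → a + c + b ≡ b + c + a
  rearrange = solve-∀
  rest : sumFrom f (suc lo) n ≡ sumFrom g (suc lo) n
  rest = sumFrom-cong f g (suc lo) n (λ j l r → let (l' , r') = widen {lo} {n} l r in
           f≗g j l' r' (λ e → <-irrefl (sym e) l))
... | no lo≢t = trans (+-assoc (f lo) _ _)
                  (trans (cong₂ _+_ (f≗g lo ≤-refl (lo<lo+suc lo n) lo≢t) rest)
                         (sym (+-assoc (g lo) _ _)))
  where
  rest = sumFrom-exchange f g (suc lo) n t (≤∧≢⇒< lo≤t lo≢t) (subst (t <_) (+-suc lo n) t<end)
           (λ j l r → let (l' , r') = widen {lo} {n} l r in f≗g j l' r')

count-point≤1 : ∀ t lo n → sumFrom (λ j → isEq j t) lo n ≤ 1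
count-point≤1 t lo zero = z≤n
count-point≤1 t lo (suc n) with lo ≟ t
... | yes refl rewrite isEq-yes {lo} refl
                     | sumFrom-zero (λ j → isEq j lo) (suc lo) n (λ j l _ → isEq-no (λ e → <-irrefl (sym e) l)) = ≤-refl
... | no lo≢t rewrite isEq-no lo≢t = count-point≤1 t (suc lo) n

count-point≡1 : ∀ t lo n → lo ≤ t → t < lo + n → sumFrom (λ j → isEq j t) lo n ≡ 1
count-point≡1 t lo n lo≤t t<end =
  ≤-antisym (count-point≤1 t lo n)
            (subst (_≤ sumFrom (λ j → isEq j t) lo n) (isEq-yes {t} refl) (term≤sumFrom _ lo n t lo≤t t<end))

transp-left : ∀ i → transp i i ≡ suc i
transp-left i with i ≟ i
... | yes _ = refl
... | no i≢i = ⊥-elim (i≢i refl)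

transp-right : ∀ i → transp i (suc i) ≡ i
transp-right i with suc i ≟ i
... | yes e = ⊥-elim (<-irrefl (sym e) ≤-refl)
... | no _ with suc i ≟ suc i
...   | yes _ = refl
...   | no ne = ⊥-elim (ne refl)

Outside : ℕ → ℕ → Set
Outside i x = (x ≢ i) × (x ≢ suc i)

transp-fixes : ∀ i x → Outside i x → transp i x ≡ x
transp-fixes i x (x≢i , x≢i+1) with x ≟ i
... | yes e = ⊥-elim (x≢i e)
... | no _ with x ≟ suc i
...   | yes e = ⊥-elim (x≢i+1 e)
...   | no _ = refl

data Place (i x : ℕ) : Set where
  left : x ≡ i → Place i x
  right : x ≡ suc i → Place i x
  outside : Outside i x → Place i x

place : ∀ i x → Place i x
place i x with x ≟ i
... | yes e = left e
... | no x≢i with x ≟ suc i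
...   | yes e = right e
...   | no x≢i+1 = outside (x≢i , x≢i+1)

transp-involutive : ∀ i x → transp i (transp i x) ≡ x
transp-involutive i x with place i x
... | left refl rewrite transp-left i = transp-right i
... | right refl rewrite transp-right i = transp-left i
... | outside o rewrite transp-fixes i x o = transp-fixes i x o

isLess-transpʳ : ∀ i x y → Outside i x → isLess x (transp i y) ≡ isLess x y
isLess-transpʳ i x y ox with place i y
... | left refl rewrite transp-left i = isLess-sucʳ-≢ (proj₁ ox)
... | right refl rewrite transp-right i = sym (isLess-sucʳ-≢ (proj₁ ox))
... | outside oy rewrite transp-fixes i y oy = refl

isLess-transpˡ : ∀ i x y → Outside i y → isLess (transp i x) y ≡ isLess x y
isLess-transpˡ i x y oy with place i x
... | left refl rewrite transp-left i = isLess-sucˡ-≢ (λ e → proj₂ oy (sym e))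
... | right refl rewrite transp-right i = sym (isLess-sucˡ-≢ (λ e → proj₂ oy (sym e)))
... | outside ox rewrite transp-fixes i x ox = refl

isLess-transp : ∀ i x y → (Outside i x ⊎ Outside i y) → isLess (transp i x) (transp i y) ≡ isLess x y
isLess-transp i x y (inj₁ ox) rewrite transp-fixes i x ox = isLess-transpʳ i x y ox
isLess-transp i x y (inj₂ oy) rewrite transp-fixes i y oy = isLess-transpˡ i x y oy

record Perm (N : ℕ) (u v : ℕ → ℕ) : Set where
  field
    right-inverse : ∀ y → u (v y) ≡ y
    left-inverse : ∀ j → v (u j) ≡ j
    fixes-outside : ∀ j → (j ≡ 0 ⊎ N < j) → u j ≡ j
open Perm public

perm-sym : ∀ {N u v} → Perm N u v → Perm N v u
perm-sym {N} {u} {v} P = record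
  { right-inverse = left-inverse P
  ; left-inverse = right-inverse P
  ; fixes-outside = λ j j-out → trans (cong v (sym (fixes-outside P j j-out))) (left-inverse P j)
  }

perm-range : ∀ {N u v} → Perm N u v → ∀ j → 1 ≤ j → j ≤ N → 1 ≤ u j × u j ≤ N
perm-range {N} {u} {v} P j 1≤j j≤N = positive , bounded
  where
  positive : 1 ≤ u j
  positive with u j ≟ 0
  ... | yes uj≡0 = ⊥-elim (<-irrefl (sym j≡0) 1≤j)
    where
    j≡0 : j ≡ 0
    j≡0 = trans (sym (left-inverse P j)) (trans (cong v uj≡0) (fixes-outside (perm-sym P) 0 (inj₁ refl)))
  ... | no uj≢0 = n≢0⇒n>0 uj≢0
  bounded : u j ≤ N
  bounded with u j ≤? N
  ... | yes uj≤N = uj≤N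
  ... | no uj≰N = ⊥-elim (<-irrefl refl (≤-<-trans j≤N (subst (N <_) uj≡j (≰⇒> uj≰N))))
    where
    uj≡j : u j ≡ j
    uj≡j = trans (sym (fixes-outside (perm-sym P) (u j) (inj₂ (≰⇒> uj≰N)))) (left-inverse P j)

isEq-perm : ∀ {N u v} → Perm N u v → ∀ j y → isEq (u j) y ≡ isEq j (v y)
isEq-perm {N} {u} {v} P j y with u j ≟ y
... | yes uj≡y = trans (isEq-yes uj≡y) (sym (isEq-yes (trans (sym (left-inverse P j)) (cong v uj≡y))))
... | no uj≢y = trans (isEq-no uj≢y) (sym (isEq-no (λ j≡vy → uj≢y (trans (cong u j≡vy) (right-inverse P y)))))

rank : ∀ {N u v} → Perm N u v → ∀ m → 1 ≤ m → m ≤ suc N → suc (sumFrom (λ j → isLess (u j) m) 1 N) ≡ m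
rank {N} {u} {v} P (suc zero) _ _ =
  cong suc (sumFrom-zero _ 1 N (λ j l r → isLess-no (proj₁ (perm-range P j l (≤-pred r)))))
rank {N} {u} {v} P (suc (suc m)) _ m+2≤N+1 = begin
    suc (sumFrom (λ j → isLess (u j) (suc (suc m))) 1 N)
  ≡⟨ cong suc (sumFrom-cong _ _ 1 N (λ j _ _ → isLess-sucʳ (u j) (suc m))) ⟩
    suc (sumFrom (λ j → isLess (u j) (suc m) + isEq (u j) (suc m)) 1 N)
  ≡⟨ cong suc (sumFrom-+ (λ j → isLess (u j) (suc m)) (λ j → isEq (u j) (suc m)) 1 N) ⟩
    suc (sumFrom (λ j → isLess (u j) (suc m)) 1 N + sumFrom (λ j → isEq (u j) (suc m)) 1 N)
  ≡⟨ cong (λ e → suc (sumFrom (λ j → isLess (u j) (suc m)) 1 N + e)) one-hit ⟩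
    suc (sumFrom (λ j → isLess (u j) (suc m)) 1 N + 1)
  ≡⟨ cong suc (+-comm _ 1) ⟩
    suc (suc (sumFrom (λ j → isLess (u j) (suc m)) 1 N))
  ≡⟨ cong suc (rank P (suc m) (s≤s z≤n) (≤-trans (n≤1+n _) m+2≤N+1)) ⟩
    suc (suc m)
  ∎
  where
  open ≡-Reasoning
  preimage = perm-range (perm-sym P) (suc m) (s≤s z≤n) (≤-pred m+2≤N+1)
  one-hit : sumFrom (λ j → isEq (u j) (suc m)) 1 N ≡ 1
  one-hit = trans (sumFrom-cong _ _ 1 N (λ j _ _ → isEq-perm P j (suc m)))
                  (count-point≡1 (v (suc m)) 1 N (proj₁ preimage) (s≤s (proj₂ preimage)))

below : (ℕ → ℕ) → ℕ → ℕ → ℕ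
below u p₀ x = sumFrom (λ q → isLess (u q) x) 1 p₀

below-extend : ∀ u p₀ y → below u (suc p₀) y ≡ below u p₀ y + isLess (u (suc p₀)) y
below-extend u p₀ y = sumFrom-snoc (λ q → isLess (u q) y) 1 p₀

Avoids : (ℕ → ℕ) → ℕ → ℕ → Set
Avoids u p₀ z = ∀ q → 1 ≤ q → q ≤ p₀ → u q ≢ z

below-skip : ∀ u p₀ z → Avoids u p₀ z → below u p₀ (suc z) ≡ below u p₀ z
below-skip u p₀ z avoid = sumFrom-cong _ _ 1 p₀ (λ j l r → isLess-sucʳ-≢ (avoid j l (≤-pred r)))

below-suc≤ : ∀ {N u v} → Perm N u v → ∀ p₀ z → below u p₀ (suc z) ≤ suc (below u p₀ z)
below-suc≤ {N} {u} {v} P p₀ z = begin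
    below u p₀ (suc z)
  ≡⟨ sumFrom-cong _ _ 1 p₀ (λ j _ _ → isLess-sucʳ (u j) z) ⟩
    sumFrom (λ q → isLess (u q) z + isEq (u q) z) 1 p₀
  ≡⟨ sumFrom-+ (λ q → isLess (u q) z) (λ q → isEq (u q) z) 1 p₀ ⟩
    below u p₀ z + hits
  ≤⟨ +-monoʳ-≤ (below u p₀ z) at-most-one-hit ⟩
    below u p₀ z + 1
  ≡⟨ +-comm _ 1 ⟩
    suc (below u p₀ z)
  ∎
  where
  open ≤-Reasoning
  hits = sumFrom (λ q → isEq (u q) z) 1 p₀
  at-most-one-hit : hits ≤ 1
  at-most-one-hit = subst (_≤ 1) (sumFrom-cong _ _ 1 p₀ (λ j _ _ → sym (isEq-perm P j z))) (count-point≤1 (v z) 1 p₀)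

below-gap : ∀ {N u v} → Perm N u v → ∀ p₀ x y → Avoids u p₀ x → x < y → below u p₀ y + x < below u p₀ x + y
below-gap {N} {u} {v} P p₀ x (suc y) avoid (s≤s x≤y) with m≤n⇒m<n∨m≡n x≤y
... | inj₂ refl rewrite below-skip u p₀ x avoid = +-monoʳ-< (below u p₀ x) (n<1+n x)
... | inj₁ x<y = ≤-<-trans (≤-trans (+-monoˡ-≤ x (below-suc≤ P p₀ y)) (below-gap P p₀ x y avoid x<y))
                           (+-monoʳ-< (below u p₀ x) (n<1+n y))

code : ℕ → (ℕ → ℕ) → ℕ → ℕ
code N u p = sumFrom (λ j → isLess (u j) (u p)) (suc p) (N ∸ p)

value-decomposition : ∀ {N u v} → Perm N u v → ∀ p₀ → p₀ < N →
  suc (below u p₀ (u (suc p₀)) + code N u (suc p₀)) ≡ u (suc p₀)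
value-decomposition {N} {u} {v} P p₀ p₀<N =
  trans (cong suc (sym split)) (rank P m (proj₁ m-range) (≤-trans (proj₂ m-range) (n≤1+n N)))
  where
  m = u (suc p₀)
  smaller = λ j → isLess (u j) m
  m-range = perm-range P (suc p₀) (s≤s z≤n) p₀<N
  split : sumFrom smaller 1 N ≡ below u p₀ m + code N u (suc p₀)
  split = begin
      sumFrom smaller 1 N
    ≡⟨ cong (sumFrom smaller 1) (sym (m+[n∸m]≡n (<⇒≤ p₀<N))) ⟩
      sumFrom smaller 1 (p₀ + (N ∸ p₀))
    ≡⟨ sumFrom-split smaller 1 p₀ (N ∸ p₀) ⟩
      below u p₀ m + sumFrom smaller (suc p₀) (N ∸ p₀)
    ≡⟨ cong (λ k → below u p₀ m + sumFrom smaller (suc p₀) k) (+-∸-assoc 1 p₀<N) ⟩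
      below u p₀ m + (isLess m m + code N u (suc p₀))
    ≡⟨ cong (λ k → below u p₀ m + (k + code N u (suc p₀))) (isLess-no {m} ≤-refl) ⟩
      below u p₀ m + code N u (suc p₀)
    ∎
    where open ≡-Reasoning

fresh-value : ∀ {N u v} → Perm N u v → ∀ p₀ → Avoids u p₀ (u (suc p₀))
fresh-value {N} {u} {v} P p₀ q _ q≤p₀ uq≡up =
  <-irrefl (trans (sym (left-inverse P q)) (trans (cong v uq≡up) (left-inverse P (suc p₀)))) (s≤s q≤p₀)

decompositions-clash : ∀ g g' c x x' → suc (g + c) ≡ x → suc (g' + c) ≡ x' → g' + x < g + x' → ⊥
decompositions-clash g g' c x x' x≡ x'≡ ineq = <-irrefl both-sides ineq
  where
  swap-sides : ∀ g g' c → g' + suc (g + c) ≡ g + suc (g' + c)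
  swap-sides = solve-∀
  both-sides : g' + x ≡ g + x'
  both-sides = trans (cong (g' +_) (sym x≡)) (trans (swap-sides g g' c) (cong (g +_) x'≡))

code-determines : ∀ {N u v u' v'} → Perm N u v → Perm N u' v' →
  (∀ k → code N u (suc k) ≡ code N u' (suc k)) → ∀ p → u p ≡ u' p
code-determines {N} {u} {v} {u'} {v'} P P' same-code = <-rec (λ p → u p ≡ u' p) agree
  where
  decomposition' : ∀ p₀ → p₀ < N → (∀ {q} → q < suc p₀ → u q ≡ u' q) →
    suc (below u p₀ (u' (suc p₀)) + code N u (suc p₀)) ≡ u' (suc p₀)
  decomposition' p₀ p₀<N earlier =
    subst₂ (λ g c → suc (g + c) ≡ u' (suc p₀)) same-prefix (sym (same-code p₀)) (value-decomposition P' p₀ p₀<N)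
    where
    same-prefix : below u' p₀ (u' (suc p₀)) ≡ below u p₀ (u' (suc p₀))
    same-prefix = sumFrom-cong _ _ 1 p₀ (λ q _ q≤p₀ → cong (λ z → isLess z (u' (suc p₀))) (sym (earlier q≤p₀)))
  agree : ∀ p → (∀ {q} → q < p → u q ≡ u' q) → u p ≡ u' p
  agree zero _ = trans (fixes-outside P 0 (inj₁ refl)) (sym (fixes-outside P' 0 (inj₁ refl)))
  agree (suc p₀) earlier with p₀ <? N
  ... | no p₀≮N = trans (fixes-outside P _ (inj₂ (s≤s (≮⇒≥ p₀≮N)))) (sym (fixes-outside P' _ (inj₂ (s≤s (≮⇒≥ p₀≮N)))))
  ... | yes p₀<N with <-cmp (u (suc p₀)) (u' (suc p₀))
  ...   | tri≈ _ same _ = same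
  ...   | tri< x<x' _ _ = ⊥-elim (decompositions-clash _ _ _ _ _ (value-decomposition P p₀ p₀<N) (decomposition' p₀ p₀<N earlier)
                                  (below-gap P p₀ _ _ (fresh-value P p₀) x<x'))
  ...   | tri> _ _ x'<x = ⊥-elim (decompositions-clash _ _ _ _ _ (decomposition' p₀ p₀<N earlier) (value-decomposition P p₀ p₀<N)
                                  (below-gap P p₀ _ _ fresh' x'<x))
    where
    fresh' : Avoids u p₀ (u' (suc p₀))
    fresh' q 1≤q q≤p₀ e = fresh-value P' p₀ q 1≤q q≤p₀ (trans (sym (earlier (s≤s q≤p₀))) e)

at : List ℕ → ℕ → ℕ
at [] _ = 0
at (h ∷ L) zero = h
at (h ∷ L) (suc k) = at L k

hd : List ℕ → ℕ
hd L = at L 0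

tl : List ℕ → List ℕ
tl [] = []
tl (_ ∷ L) = L

tower-at : ∀ T k → tower T (suc k) ≡ at T k
tower-at [] k = refl
tower-at (h ∷ T) zero = refl
tower-at (h ∷ T) (suc k) = tower-at T k

record ListsFrom (c : ℕ → ℕ) (p : ℕ) (M : List ℕ) : Set where
  constructor listing
  field entry : ∀ k → at M k ≡ c (p + k)
open ListsFrom

listsFrom-head : ∀ {c p M} → ListsFrom c p M → hd M ≡ c p
listsFrom-head {c} {p} lists = trans (entry lists 0) (cong c (+-identityʳ p))

listsFrom-tail : ∀ {c p M} → ListsFrom c p M → ListsFrom c (suc p) (tl M)
listsFrom-tail {c} {p} {[]} lists = listing λ k → trans (entry lists (suc k)) (cong c (+-suc p k))
listsFrom-tail {c} {p} {_ ∷ M} lists = listing λ k → trans (entry lists (suc k)) (cong c (+-suc p k))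

listsFrom-cons : ∀ {c p h M} → h ≡ c p → ListsFrom c (suc p) M → ListsFrom c p (h ∷ M)
listsFrom-cons {c} {p} {h} {M} h≡ lists = listing entries
  where
  entries : ∀ k → at (h ∷ M) k ≡ c (p + k)
  entries zero = trans h≡ (cong c (sym (+-identityʳ p)))
  entries (suc k) = trans (entry lists k) (cong c (sym (+-suc p k)))

listsFrom-cong : ∀ {c c' p M} → (∀ k → c (p + k) ≡ c' (p + k)) → ListsFrom c p M → ListsFrom c' p M
listsFrom-cong c≗c' lists = listing λ k → trans (entry lists k) (c≗c' k)

-- The four moves of the sliding procedure at tower p (value s, remaining
-- heights L); phrased with hd/tl so that the empty list is covered too.

slide-pass : ∀ s p L → p + hd L < s → slideAt s p L ≡ hd L ∷ slideAt s (suc p) (tl L)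
slide-pass s p [] p+0<s rewrite +-∸-assoc 1 (subst (_< s) (+-identityʳ p) p+0<s) = refl
slide-pass s p (h ∷ L) p+h<s with p + h <? s
... | yes _ = refl
... | no p+h≮s = ⊥-elim (p+h≮s p+h<s)

slide-add : ∀ s p L → s ≡ p + hd L → slideAt s p L ≡ suc (hd L) ∷ tl L
slide-add s p [] s≡p+0 rewrite s≡p+0 | +-identityʳ p | n∸n≡0 p = refl
slide-add s p (h ∷ L) s≡p+h with p + h <? s
... | yes p+h<s = ⊥-elim (<-irrefl (sym s≡p+h) p+h<s)
... | no _ with s ≟ p + h
...   | yes _ = refl
...   | no s≢p+h = ⊥-elim (s≢p+h s≡p+h)

slide-delete : ∀ s p L h → hd L ≡ suc h → s ≡ p + h → slideAt s p L ≡ h ∷ tl L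
slide-delete s p (.(suc h) ∷ L) h refl s≡p+h with p + suc h <? s
... | yes p+h+1<s = ⊥-elim (<-asym p+h+1<s (subst (_< p + suc h) (sym s≡p+h) (+-monoʳ-< p (n<1+n h))))
... | no _ with s ≟ p + suc h
...   | yes s≡p+h+1 = ⊥-elim (<-irrefl (trans (sym s≡p+h) s≡p+h+1) (+-monoʳ-< p (n<1+n h)))
...   | no _ with s ≟ p + h
...     | yes _ = refl
...     | no s≢p+h = ⊥-elim (s≢p+h s≡p+h)

slide-raise : ∀ s p L → 1 ≤ hd L → suc s < p + hd L → slideAt s p L ≡ hd L ∷ slideAt (suc s) (suc p) (tl L)
slide-raise s p (suc h ∷ L) _ s+1<p+h+1 with p + suc h <? s
... | yes p+h+1<s = ⊥-elim (<-asym p+h+1<s (<-trans (n<1+n s) s+1<p+h+1))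
... | no _ with s ≟ p + suc h
...   | yes s≡p+h+1 = ⊥-elim (<-asym (subst (suc s <_) (sym s≡p+h+1) s+1<p+h+1) (n<1+n s))
...   | no _ with s ≟ p + h
...     | yes s≡p+h = ⊥-elim (<-irrefl refl (subst (suc s <_) (trans (+-suc p h) (cong suc (sym s≡p+h))) s+1<p+h+1))
...     | no _ = refl

-- Linear arithmetic behind the moves: the running value s of the procedure
-- compared with p + (code at p), where value x = 1 + g + c (g smaller values
-- before position p = p₀+1, c after) and s + gᵢ = i + p₀.

reaches-exactly : ∀ s g i p₀ c → s + g ≡ i + p₀ → suc (g + c) ≡ i → s ≡ suc p₀ + c
reaches-exactly s g i p₀ c s+g≡ i≡ = +-cancelʳ-≡ g s (suc p₀ + c) (begin
    s + g            ≡⟨ s+g≡ ⟩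
    i + p₀           ≡⟨ cong (_+ p₀) (sym i≡) ⟩
    suc (g + c) + p₀ ≡⟨ rearrange g c p₀ ⟩
    suc p₀ + c + g   ∎)
  where
  open ≡-Reasoning
  rearrange : ∀ g c p₀ → suc (g + c) + p₀ ≡ suc p₀ + c + g
  rearrange = solve-∀

passes-below : ∀ s gᵢ gₓ i x p₀ c → s + gᵢ ≡ i + p₀ → suc (gₓ + c) ≡ x → gᵢ + x < gₓ + i → suc p₀ + c < s
passes-below s gᵢ gₓ i x p₀ c s+g≡ x≡ gap = +-cancelʳ-< (gᵢ + gₓ) (suc p₀ + c) s (begin-strict
    suc p₀ + c + (gᵢ + gₓ)  ≡⟨ rearrange p₀ c gᵢ gₓ ⟩
    p₀ + (gᵢ + suc (gₓ + c)) ≡⟨ cong (λ y → p₀ + (gᵢ + y)) x≡ ⟩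
    p₀ + (gᵢ + x)           <⟨ +-monoʳ-< p₀ gap ⟩
    p₀ + (gₓ + i)           ≡⟨ rearrange' p₀ gₓ i ⟩
    i + p₀ + gₓ             ≡⟨ cong (_+ gₓ) (sym s+g≡) ⟩
    s + gᵢ + gₓ             ≡⟨ +-assoc s gᵢ gₓ ⟩
    s + (gᵢ + gₓ)           ∎)
  where
  open ≤-Reasoning
  rearrange : ∀ p₀ c gᵢ gₓ → suc p₀ + c + (gᵢ + gₓ) ≡ p₀ + (gᵢ + suc (gₓ + c))
  rearrange = solve-∀
  rearrange' : ∀ p₀ gₓ i → p₀ + (gₓ + i) ≡ i + p₀ + gₓ
  rearrange' = solve-∀

passes-above : ∀ s g gₓ i x p₀ c → s + g ≡ i + p₀ → suc (gₓ + c) ≡ x → gₓ + suc i < g + x → suc s < suc p₀ + c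
passes-above s g gₓ i x p₀ c s+g≡ x≡ gap = +-cancelʳ-< (g + gₓ) (suc s) (suc p₀ + c) (begin-strict
    suc s + (g + gₓ)        ≡⟨ cong suc (sym (+-assoc s g gₓ)) ⟩
    suc (s + g + gₓ)        ≡⟨ cong (λ y → suc (y + gₓ)) s+g≡ ⟩
    suc (i + p₀ + gₓ)       ≡⟨ rearrange i p₀ gₓ ⟩
    p₀ + (gₓ + suc i)       <⟨ +-monoʳ-< p₀ gap ⟩
    p₀ + (g + x)            ≡⟨ cong (λ y → p₀ + (g + y)) (sym x≡) ⟩
    p₀ + (g + suc (gₓ + c)) ≡⟨ rearrange' p₀ g gₓ c ⟩
    suc p₀ + c + (g + gₓ)   ∎)
  where
  open ≤-Reasoning
  rearrange : ∀ i p₀ gₓ → suc (i + p₀ + gₓ) ≡ p₀ + (gₓ + suc i)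
  rearrange = solve-∀
  rearrange' : ∀ p₀ g gₓ c → p₀ + (g + suc (gₓ + c)) ≡ suc p₀ + c + (g + gₓ)
  rearrange' = solve-∀

transp-perm : ∀ {N u v} → Perm N u v → ∀ i → 1 ≤ i → suc i ≤ N →
  Perm N (λ j → transp i (u j)) (λ y → v (transp i y))
transp-perm {N} {u} {v} P i 1≤i i+1≤N = record
  { right-inverse = λ y → trans (cong (transp i) (right-inverse P (transp i y))) (transp-involutive i y)
  ; left-inverse = λ j → trans (cong v (transp-involutive i (u j))) (left-inverse P j)
  ; fixes-outside = λ j j-out → trans (cong (transp i) (fixes-outside P j j-out)) (transp-fixes i j (unmoved j j-out))
  }
  where
  unmoved : ∀ j → (j ≡ 0 ⊎ N < j) → Outside i j
  unmoved j (inj₁ refl) = (λ 0≡i → <-irrefl 0≡i 1≤i) , (λ ())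
  unmoved j (inj₂ N<j) = (λ j≡i → <-irrefl refl (≤-trans (subst (N <_) j≡i N<j) (≤-trans (n≤1+n i) i+1≤N)))
                       , (λ j≡i+1 → <-irrefl refl (<-≤-trans (subst (N <_) j≡i+1 N<j) i+1≤N))

-- The values i and i+1 sit at
-- the positions a and b; only the code entry at min a b changes.
module Sliding {N : ℕ} {u v : ℕ → ℕ} (P : Perm N u v) (i : ℕ) (1≤i : 1 ≤ i) (i+1≤N : suc i ≤ N) where

  a b : ℕ
  a = v i
  b = v (suc i)

  u' : ℕ → ℕ
  u' j = transp i (u j)

  c c' : ℕ → ℕ
  c = code N u
  c' = code N u'

  u-a : u a ≡ i
  u-a = right-inverse P i
  u-b : u b ≡ suc i
  u-b = right-inverse P (suc i)

  a-range = perm-range (perm-sym P) i 1≤i (≤-trans (n≤1+n i) i+1≤N)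
  b-range = perm-range (perm-sym P) (suc i) (s≤s z≤n) i+1≤N

  holds-i : ∀ {j} → u j ≡ i → j ≡ a
  holds-i {j} uj≡i = trans (sym (left-inverse P j)) (cong v uj≡i)
  holds-i+1 : ∀ {j} → u j ≡ suc i → j ≡ b
  holds-i+1 {j} uj≡i+1 = trans (sym (left-inverse P j)) (cong v uj≡i+1)

  outside-value : ∀ j → j ≢ a → j ≢ b → Outside i (u j)
  outside-value j j≢a j≢b = (λ e → j≢a (holds-i e)) , (λ e → j≢b (holds-i+1 e))

  in-code-range : ∀ q t → q ≤ N → t ≤ N → t < suc q + (N ∸ q)
  in-code-range q t q≤N t≤N = s≤s (subst (t ≤_) (sym (m+[n∸m]≡n q≤N)) t≤N)

  code-unmoved : ∀ q → q ≢ a → q ≢ b → c' q ≡ c q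
  code-unmoved q q≢a q≢b = sumFrom-cong _ _ (suc q) (N ∸ q)
    (λ j _ _ → isLess-transp i (u j) (u q) (inj₂ (outside-value q q≢a q≢b)))

  code-beyond-both : ∀ q → a ≤ q → b ≤ q → c' q ≡ c q
  code-beyond-both q a≤q b≤q = sumFrom-cong _ _ (suc q) (N ∸ q) (λ j q<j _ →
    isLess-transp i (u j) (u q) (inj₁ (outside-value j (λ j≡a → <-irrefl refl (≤-trans q<j (subst (_≤ q) (sym j≡a) a≤q)))
                                                       (λ j≡b → <-irrefl refl (≤-trans q<j (subst (_≤ q) (sym j≡b) b≤q))))))

  code-after-a : ∀ q → a < q → c' q ≡ c q
  code-after-a q a<q with b ≤? q
  ... | yes b≤q = code-beyond-both q (<⇒≤ a<q) b≤q
  ... | no b≰q = code-unmoved q (λ q≡a → <-irrefl (sym q≡a) a<q) (λ q≡b → b≰q (subst (_≤ q) q≡b ≤-refl))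

  code-after-b : ∀ q → b < q → c' q ≡ c q
  code-after-b q b<q with a ≤? q
  ... | yes a≤q = code-beyond-both q a≤q (<⇒≤ b<q)
  ... | no a≰q = code-unmoved q (λ q≡a → a≰q (subst (_≤ q) q≡a ≤-refl)) (λ q≡b → <-irrefl (sym q≡b) b<q)

  -- If i comes first, position a gains the new inversion with position b.
  code-rise : a < b → c' a ≡ suc (c a)
  code-rise a<b = begin
      c' a                    ≡⟨ sym (+-identityʳ _) ⟩
      c' a + 0                ≡⟨ cong (c' a +_) (sym old-at-b) ⟩
      c' a + old b            ≡⟨ exchange ⟩
      c a + new b             ≡⟨ cong (c a +_) new-at-b ⟩
      c a + 1                 ≡⟨ +-comm (c a) 1 ⟩
      suc (c a)               ∎
    where
    open ≡-Reasoning
    new = λ j → isLess (u' j) (u' a)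
    old = λ j → isLess (u j) (u a)
    exchange = sumFrom-exchange new old (suc a) (N ∸ a) b a<b (in-code-range a b (proj₂ a-range) (proj₂ b-range))
                 (λ j a<j _ j≢b → isLess-transp i (u j) (u a) (inj₁ (outside-value j (λ j≡a → <-irrefl (sym j≡a) a<j) j≢b)))
    old-at-b : old b ≡ 0
    old-at-b rewrite u-a | u-b = isLess-no (n≤1+n i)
    new-at-b : new b ≡ 1
    new-at-b rewrite u-a | u-b | transp-left i | transp-right i = isLess-yes (n<1+n i)

  -- If i+1 comes first, position b loses its inversion with position a.
  code-fall : b < a → c b ≡ suc (c' b)
  code-fall b<a = begin
      c b                     ≡⟨ sym (+-identityʳ _) ⟩
      c b + 0                 ≡⟨ cong (c b +_) (sym new-at-a) ⟩
      c b + new a             ≡⟨ exchange ⟩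
      c' b + old a            ≡⟨ cong (c' b +_) old-at-a ⟩
      c' b + 1                ≡⟨ +-comm (c' b) 1 ⟩
      suc (c' b)              ∎
    where
    open ≡-Reasoning
    new = λ j → isLess (u' j) (u' b)
    old = λ j → isLess (u j) (u b)
    exchange = sumFrom-exchange old new (suc b) (N ∸ b) a b<a (in-code-range b a (proj₂ b-range) (proj₂ a-range))
                 (λ j b<j _ j≢a → sym (isLess-transp i (u j) (u b) (inj₁ (outside-value j j≢a (λ j≡b → <-irrefl (sym j≡b) b<j)))))
    new-at-a : new a ≡ 0
    new-at-a rewrite u-a | u-b | transp-left i | transp-right i = isLess-no (n≤1+n i)
    old-at-a : old a ≡ 1
    old-at-a rewrite u-a | u-b = isLess-yes (n<1+n i)

  -- Invariant when the procedure is about to examine tower p₀+1 with value s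
  -- and remaining heights L: no earlier position holds i or i+1, the value is
  -- s = i + #{q ≤ p₀ | u q > i+1}, and L lists the old code from p₀+1 on.
  record Reaches (p₀ s : ℕ) (L : List ℕ) : Set where
    field
      prefix-unmoved : ∀ q → 1 ≤ q → q ≤ p₀ → Outside i (u q)
      running-value : s + below u p₀ (suc (suc i)) ≡ i + p₀
      remaining : ListsFrom c (suc p₀) L
  open Reaches

  record Passes (p₀ s : ℕ) (L : List ℕ) : Set where
    field
      next-value : ℕ
      moves-on : slideAt s (suc p₀) L ≡ hd L ∷ slideAt next-value (suc (suc p₀)) (tl L)
      reaches-next : Reaches (suc p₀) next-value (tl L)
  open Passes

  module AtTower {p₀ s : ℕ} {L : List ℕ} (st : Reaches p₀ s L) (p≤a : suc p₀ ≤ a) where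
    p x : ℕ
    p = suc p₀
    x = u p

    avoids-i : Avoids u p₀ i
    avoids-i q 1≤q q≤p₀ = proj₁ (prefix-unmoved st q 1≤q q≤p₀)
    avoids-i+1 : Avoids u p₀ (suc i)
    avoids-i+1 q 1≤q q≤p₀ = proj₂ (prefix-unmoved st q 1≤q q≤p₀)

    running-i+1 : s + below u p₀ (suc i) ≡ i + p₀
    running-i+1 = trans (cong (s +_) (sym (below-skip u p₀ (suc i) avoids-i+1))) (running-value st)
    running-i : s + below u p₀ i ≡ i + p₀
    running-i = trans (cong (s +_) (sym (below-skip u p₀ i avoids-i))) running-i+1

    p≤b : p ≤ b
    p≤b with b ≤? p₀
    ... | yes b≤p₀ = ⊥-elim (avoids-i+1 b (proj₁ b-range) b≤p₀ u-b)
    ... | no b≰p₀ = ≰⇒> b≰p₀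

    decomposition : suc (below u p₀ x + c p) ≡ x
    decomposition = value-decomposition P p₀ (≤-trans p≤a (proj₂ a-range))

    head≡ : hd L ≡ c p
    head≡ = listsFrom-head (remaining st)

    -- x = i: the procedure adds a box here, as the code entry at a rises.
    adds : x ≡ i → ListsFrom c' p (slideAt s p L)
    adds x≡i = subst (ListsFrom c' p) (sym (slide-add s p L s≡p+h))
                 (listsFrom-cons new-head (listsFrom-cong later (listsFrom-tail (remaining st))))
      where
      p≡a : p ≡ a
      p≡a = holds-i x≡i
      a<b : a < b
      a<b = subst (_< b) p≡a (≤∧≢⇒< p≤b (λ p≡b → 1+n≢n (trans (sym u-b) (trans (cong u (sym p≡b)) x≡i))))
      s≡p+h : s ≡ p + hd L
      s≡p+h = trans (reaches-exactly s (below u p₀ i) i p₀ (c p) running-i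
                       (subst (λ z → suc (below u p₀ z + c p) ≡ z) x≡i decomposition))
                    (cong (p +_) (sym head≡))
      new-head : suc (hd L) ≡ c' p
      new-head = trans (cong suc head≡) (sym (subst (λ z → c' z ≡ suc (c z)) (sym p≡a) (code-rise a<b)))
      later : ∀ k → c (suc p + k) ≡ c' (suc p + k)
      later k = sym (code-after-a (suc p + k) (subst (_< suc p + k) p≡a (s≤s (m≤m+n p k))))

    -- x = i+1: the procedure deletes a box here, as the code entry at b falls.
    deletes : x ≡ suc i → ListsFrom c' p (slideAt s p L)
    deletes x≡i+1 = subst (ListsFrom c' p) (sym (slide-delete s p L (c' p) (trans head≡ fall) s≡p+h'))
                      (listsFrom-cons refl (listsFrom-cong later (listsFrom-tail (remaining st))))
      where
      p≡b : p ≡ b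
      p≡b = holds-i+1 x≡i+1
      b<a : b < a
      b<a = subst (_< a) p≡b (≤∧≢⇒< p≤a (λ p≡a → 1+n≢n (trans (sym x≡i+1) (trans (cong u p≡a) u-a))))
      fall : c p ≡ suc (c' p)
      fall = subst (λ z → c z ≡ suc (c' z)) (sym p≡b) (code-fall b<a)
      i≡ : suc (below u p₀ (suc i) + c' p) ≡ i
      i≡ = suc-injective (begin
          suc (suc (below u p₀ (suc i) + c' p)) ≡⟨ cong suc (sym (+-suc _ (c' p))) ⟩
          suc (below u p₀ (suc i) + suc (c' p)) ≡⟨ cong (λ z → suc (below u p₀ (suc i) + z)) (sym fall) ⟩
          suc (below u p₀ (suc i) + c p)        ≡⟨ subst (λ z → suc (below u p₀ z + c p) ≡ z) x≡i+1 decomposition ⟩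
          suc i                                 ∎)
        where open ≡-Reasoning
      s≡p+h' : s ≡ p + c' p
      s≡p+h' = reaches-exactly s (below u p₀ (suc i)) i p₀ (c' p) running-i+1 i≡
      later : ∀ k → c (suc p + k) ≡ c' (suc p + k)
      later k = sym (code-after-b (suc p + k) (subst (_< suc p + k) p≡b (s≤s (m≤m+n p k))))

    head-kept : Outside i x → hd L ≡ c' p
    head-kept (x≢i , x≢i+1) =
      trans head≡ (sym (code-unmoved p (λ p≡a → x≢i (trans (cong u p≡a) u-a)) (λ p≡b → x≢i+1 (trans (cong u p≡b) u-b))))

    next-unmoved : Outside i x → ∀ q → 1 ≤ q → q ≤ p → Outside i (u q)
    next-unmoved o q 1≤q q≤p with m≤n⇒m<n∨m≡n q≤p
    ... | inj₁ q<p = prefix-unmoved st q 1≤q (≤-pred q<p)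
    ... | inj₂ refl = o

    passes-lower : x < i → Passes p₀ s L
    passes-lower x<i = record
      { next-value = s
      ; moves-on = slide-pass s p L (subst (λ h → p + h < s) (sym head≡)
          (passes-below s (below u p₀ i) (below u p₀ x) i x p₀ (c p) running-i decomposition
                        (below-gap P p₀ x i (fresh-value P p₀) x<i)))
      ; reaches-next = record
          { prefix-unmoved = next-unmoved ((λ x≡i → <-irrefl x≡i x<i) , (λ x≡i+1 → <-irrefl x≡i+1 (<-trans x<i (n<1+n i))))
          ; running-value = begin
              s + below u p (suc (suc i))              ≡⟨ cong (s +_) (below-extend u p₀ (suc (suc i))) ⟩
              s + (below u p₀ (suc (suc i)) + isLess x (suc (suc i)))
                                                       ≡⟨ cong (λ e → s + (below u p₀ (suc (suc i)) + e)) (isLess-yes (<-trans x<i (<-trans (n<1+n i) (n<1+n (suc i))))) ⟩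
              s + (below u p₀ (suc (suc i)) + 1)      ≡⟨ sym (+-assoc s _ 1) ⟩
              s + below u p₀ (suc (suc i)) + 1        ≡⟨ cong (_+ 1) (running-value st) ⟩
              i + p₀ + 1                               ≡⟨ +-assoc i p₀ 1 ⟩
              i + (p₀ + 1)                             ≡⟨ cong (i +_) (+-comm p₀ 1) ⟩
              i + p                                    ∎
          ; remaining = listsFrom-tail (remaining st)
          }
      }
      where open ≡-Reasoning

    passes-upper : suc i < x → Passes p₀ s L
    passes-upper i+1<x = record
      { next-value = suc s
      ; moves-on = slide-raise s p L (subst (1 ≤_) (sym head≡) code-positive) (subst (λ h → suc s < p + h) (sym head≡)
          (passes-above s (below u p₀ (suc i)) (below u p₀ x) i x p₀ (c p) running-i+1 decomposition
                        (below-gap P p₀ (suc i) x avoids-i+1 i+1<x)))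
      ; reaches-next = record
          { prefix-unmoved = next-unmoved ((λ x≡i → <-asym (subst (suc i <_) x≡i i+1<x) (n<1+n i)) , (λ x≡i+1 → <-irrefl (sym x≡i+1) i+1<x))
          ; running-value = begin
              suc s + below u p (suc (suc i))           ≡⟨ cong (suc s +_) (below-extend u p₀ (suc (suc i))) ⟩
              suc s + (below u p₀ (suc (suc i)) + isLess x (suc (suc i)))
                                                         ≡⟨ cong (λ e → suc s + (below u p₀ (suc (suc i)) + e)) (isLess-no i+1<x) ⟩
              suc s + (below u p₀ (suc (suc i)) + 0)    ≡⟨ cong (λ e → suc (s + e)) (+-identityʳ _) ⟩
              suc (s + below u p₀ (suc (suc i)))        ≡⟨ cong suc (running-value st) ⟩
              suc (i + p₀)                               ≡⟨ sym (+-suc i p₀) ⟩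
              i + p                                      ∎
          ; remaining = listsFrom-tail (remaining st)
          }
      }
      where
      open ≡-Reasoning
      -- position b lies after p and holds the smaller value i+1
      code-positive : 1 ≤ c p
      code-positive = subst (_≤ c p) (isLess-yes (subst (_< x) (sym u-b) i+1<x))
        (term≤sumFrom (λ j → isLess (u j) x) (suc p) (N ∸ p) b
          (≤∧≢⇒< p≤b (λ p≡b → <-irrefl (trans (sym u-b) (cong u (sym p≡b))) i+1<x))
          (in-code-range p b (≤-trans p≤a (proj₂ a-range)) (proj₂ b-range)))

    passes : Outside i x → Passes p₀ s L
    passes (x≢i , x≢i+1) with <-cmp x i
    ... | tri< x<i _ _ = passes-lower x<i
    ... | tri≈ _ x≡i _ = ⊥-elim (x≢i x≡i)
    ... | tri> _ _ i<x = passes-upper (≤∧≢⇒< i<x (λ i+1≡x → x≢i+1 (sym i+1≡x)))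

  simulate : ∀ n p₀ s L → suc p₀ + n ≡ a → Reaches p₀ s L → ListsFrom c' (suc p₀) (slideAt s (suc p₀) L)
  simulate n p₀ s L p+n≡a st with place i (u (suc p₀))
  ... | left x≡i = AtTower.adds st (subst (suc p₀ ≤_) p+n≡a (m≤m+n _ n)) x≡i
  ... | right x≡i+1 = AtTower.deletes st (subst (suc p₀ ≤_) p+n≡a (m≤m+n _ n)) x≡i+1
  ... | outside o with n
  ...   | zero = ⊥-elim (proj₁ o (trans (cong u (trans (sym (+-identityʳ _)) p+n≡a)) u-a))
  ...   | suc n' = subst (ListsFrom c' (suc p₀)) (sym (moves-on step))
                     (listsFrom-cons (AtTower.head-kept st p≤a o)
                       (simulate n' (suc p₀) (next-value step) (tl L) (trans (sym (+-suc (suc p₀) n')) p+n≡a) (reaches-next step)))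
    where
    p≤a : suc p₀ ≤ a
    p≤a = subst (suc p₀ ≤_) p+n≡a (m≤m+n _ (suc n'))
    step : Passes p₀ s L
    step = AtTower.passes st p≤a o

  slide-code : ∀ T → ListsFrom c 1 T → ListsFrom c' 1 (slide i T)
  slide-code T lists = simulate (a ∸ 1) 0 i T (m+[n∸m]≡n (proj₁ a-range)) initial
    where
    initial : Reaches 0 i T
    initial = record
      { prefix-unmoved = λ { zero () _ ; (suc _) _ () }
      ; running-value = refl
      ; remaining = lists
      }

record Encodes (N : ℕ) (T : TowerDiagram) (v : ℕ → ℕ) : Set where
  field
    word : ℕ → ℕ
    inverse : Perm N word v
    heights : ListsFrom (code N word) 1 T
open Encodes

empty-encodes : ∀ N → Encodes N ∅ᵀ (λ y → y)
empty-encodes N = record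
  { word = λ y → y
  ; inverse = record { right-inverse = λ _ → refl ; left-inverse = λ _ → refl ; fixes-outside = λ _ _ → refl }
  ; heights = listing λ k → sym (sumFrom-zero _ (suc (suc k)) (N ∸ suc k) (λ j k+2≤j _ → isLess-no (≤-trans (n≤1+n _) k+2≤j)))
  }

Letter : ℕ → ℕ → Set
Letter N i = 1 ≤ i × suc i ≤ N

slide-encodes : ∀ {N T v} i → Letter N i → Encodes N T v → Encodes N (slide i T) (λ y → v (transp i y))
slide-encodes {N} {T} i (1≤i , i+1≤N) E = record
  { word = λ j → transp i (word E j)
  ; inverse = transp-perm (inverse E) i 1≤i i+1≤N
  ; heights = Sliding.slide-code (inverse E) i 1≤i i+1≤N T (heights E)
  }

slideWord-encodes : ∀ {N} α T v → All (Letter N) α → Encodes N T v → Encodes N (slideWord α T) (λ y → v (perm α y))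
slideWord-encodes [] T v [] E = E
slideWord-encodes (i ∷ α) T v (letter ∷ letters) E =
  slideWord-encodes α (slide i T) (λ y → v (transp i y)) letters (slide-encodes i letter E)

towerOf-encodes : ∀ N α → All (Letter N) α → Encodes N (towerOf α) (perm α)
towerOf-encodes N α letters = slideWord-encodes α ∅ᵀ (λ y → y) letters (empty-encodes N)

maxLetter : List ℕ → ℕ
maxLetter = foldr _⊔_ 0

letters-bounded : ∀ α M → All (1 ≤_) α → maxLetter α ≤ M → All (Letter (suc M)) α
letters-bounded [] M [] _ = []
letters-bounded (i ∷ α) M (1≤i ∷ positive) max≤M =
  (1≤i , s≤s (≤-trans (m≤m⊔n i (maxLetter α)) max≤M)) ∷ letters-bounded α M positive (≤-trans (m≤n⊔m i (maxLetter α)) max≤M)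

inverses-agree : ∀ {N N' u v u' v'} → Perm N u v → Perm N' u' v' → (∀ j → u j ≡ u' j) → ∀ y → v y ≡ v' y
inverses-agree {u = u} {v} {u'} {v'} P P' u≗u' y = begin
    v y             ≡⟨ cong v (sym (right-inverse P' y)) ⟩
    v (u' (v' y))   ≡⟨ cong v (sym (u≗u' (v' y))) ⟩
    v (u (v' y))    ≡⟨ left-inverse P (v' y) ⟩
    v' y            ∎
  where open ≡-Reasoning

same-tower⇒same-word : ∀ {N T T' v v'} (E : Encodes N T v) (E' : Encodes N T' v') → T ≈ᵀ T' → ∀ p → word E p ≡ word E' p
same-tower⇒same-word {N} {T} {T'} E E' T≈T' = code-determines (inverse E) (inverse E') same-code
  where
  same-code : ∀ k → code N (word E) (suc k) ≡ code N (word E') (suc k)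
  same-code k = begin
      code N (word E) (suc k)   ≡⟨ sym (entry (heights E) k) ⟩
      at T k                    ≡⟨ sym (tower-at T k) ⟩
      tower T (suc k)           ≡⟨ T≈T' (suc k) ⟩
      tower T' (suc k)          ≡⟨ tower-at T' k ⟩
      at T' k                   ≡⟨ entry (heights E') k ⟩
      code N (word E') (suc k)  ∎
    where open ≡-Reasoning

same-word⇒same-tower : ∀ {N T T' v v'} (E : Encodes N T v) (E' : Encodes N T' v') → (∀ p → word E p ≡ word E' p) → T ≈ᵀ T'
same-word⇒same-tower E E' same zero = refl
same-word⇒same-tower {N} {T} {T'} E E' same (suc k) = begin
    tower T (suc k)           ≡⟨ tower-at T k ⟩
    at T k                    ≡⟨ entry (heights E) k ⟩
    code N (word E) (suc k)   ≡⟨ sumFrom-cong _ _ (suc (suc k)) (N ∸ suc k) (λ j _ _ → cong₂ isLess (same j) (same (suc k))) ⟩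
    code N (word E') (suc k)  ≡⟨ sym (entry (heights E') k) ⟩
    at T' k                   ≡⟨ sym (tower-at T' k) ⟩
    tower T' (suc k)          ∎
  where open ≡-Reasoning

theorem2p1 : (α β : List ℕ) → All (1 ≤_) α → All (1 ≤_) β →
    ((towerOf α ≈ᵀ towerOf β → perm α ≈ᵖ perm β) ×
     (perm α ≈ᵖ perm β → towerOf α ≈ᵀ towerOf β))
theorem2p1 α β positiveα positiveβ = tower⇒perm , perm⇒tower
  where
  M = maxLetter α ⊔ maxLetter β
  Eα = towerOf-encodes (suc M) α (letters-bounded α M positiveα (m≤m⊔n _ _))
  Eβ = towerOf-encodes (suc M) β (letters-bounded β M positiveβ (m≤n⊔m _ _))
  tower⇒perm : towerOf α ≈ᵀ towerOf β → perm α ≈ᵖ perm β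
  tower⇒perm same = inverses-agree (inverse Eα) (inverse Eβ) (same-tower⇒same-word Eα Eβ same)
  perm⇒tower : perm α ≈ᵖ perm β → towerOf α ≈ᵀ towerOf β
  perm⇒tower same = same-word⇒same-tower Eα Eβ (inverses-agree (perm-sym (inverse Eα)) (perm-sym (inverse Eβ)) same)
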